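{- Let $X$ be a finite simple graph and let $T$ be its modular tree. Then ${\rm Aut}(X)\cong{\rm Aut}(T)$, where ${\rm Aut}(T)$ is the group of automorphisms of $T$ that preserve the types of vertices (normal/marker), the types of edges (normal/tree) and the orientation of tree edges.
   Context: A module of a graph $X$ is a set $M\subseteq V(X)$ such that every $x\in V(X)\setminus M$ is adjacent either to all vertices of $M$ or to none. It is trivial if $M=V(X)$ or $|M|=1$. A graph is prime if all its modules are trivial, and degenerate if it is $K_n$ or $\overline{K_n}$. For a modular partition $\mathcal P=\{M_1,\dots,M_k\}$ of $V(X)$ (a partition into modules), the quotient $X/\mathcal P$ has vertices $m_1,\dots,m_k$ with $m_im_j$ an edge iff all edges between $M_i$ and $M_j$ are present. The modular decomposition: if $X$ is prime or degenerate, stop; if $X$ and $\overline X$ are connected, use the partition $\mathcal P$ into inclusion-maximal proper modules; if $X$ is disconnected and $\overline X$ connected, use the partition into connected components of $X$; if $\overline X$ is disconnected and $X$ connected, use the partition into connected components of $\overline X$; then recurse on each $X[M_i]$. The modular tree $T$ of $X$ is defined recursively; it has normal and marker vertices, normal edges and directed tree edges, and a root node. If $X$ is prime or degenerate, $T=X$ (all normal) with root node $T$. Otherwise, with $\mathcal P=\{M_1,\dots,M_k\}$ the partition used and $T_1,\dots,T_k$ the modular trees of $X[M_1],\dots,X[M_k]$, $T$ is the disjoint union of $T_1,\dots,T_k$ and of the quotient $X/\mathcal P$ (the root node of $T$), whose vertices $m_1,\dots,m_k$ are marker vertices; for each $i$ a new marker vertex $m_i'$ is added, joined by normal edges exactly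 to the vertices of the root node of $T_i$, and a tree edge directed from $m_i$ to $m_i'$ is added. -}

module Defs where

open import Data.Nat using (ℕ)
open import Data.Fin using (Fin; _≟_)
open import Data.Bool using (Bool; true; false)
open import Data.Product using (Σ; _×_; _,_; proj₁; proj₂)
open import Data.Sum using (_⊎_)
open import Data.Empty using (⊥)
open import Data.Unit using (⊤)
open import Relation.Nullary using (¬_)
open import Relation.Nullary.Decidable using (⌊_⌋)
open import Relation.Binary.PropositionalEquality using (_≡_; _≢_)

record Graph (V : Set) : Set where
  field
    adj   : V → V → Bool
    sym   : ∀ u v → adj u v ≡ adj v u
    irref : ∀ v → adj v v ≡ false
open Graph public

Subset : Set → Set
Subset V = V → Bool

module _ {V : Set} (X : Graph V) where

  Edge : V → V → Set
  Edge u v = adj X u v ≡ true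

  CoEdge : V → V → Set
  CoEdge u v = (u ≢ v) × (adj X u v ≡ false)

data Reach {V : Set} (R : V → V → Set) : V → V → Set where
  here : ∀ {v} → Reach R v v
  step : ∀ {u v w} → R u v → Reach R v w → Reach R u w

Connected : {V : Set} → (V → V → Set) → Set
Connected {V} R = ∀ (u v : V) → Reach R u v

module _ {V : Set} (X : Graph V) where

  IsModule : Subset V → Set
  IsModule M =
    Σ V (λ v → M v ≡ true) ×
    (∀ x → M x ≡ false →
      (∀ m → M m ≡ true → adj X x m ≡ true) ⊎
      (∀ m → M m ≡ true → adj X x m ≡ false))

  Trivial : Subset V → Set
  Trivial M =
    (∀ v → M v ≡ true) ⊎
    Σ V (λ v → M v ≡ true × (∀ w → M w ≡ true → w ≡ v))

  Prime : Set
  Prime = ∀ M → IsModule M → Trivial M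

  Degenerate : Set
  Degenerate =
    (∀ u v → u ≢ v → adj X u v ≡ true) ⊎ (∀ u v → adj X u v ≡ false)

  Proper : Subset V → Set
  Proper M = Σ V (λ v → M v ≡ false)

  MaxProperModule : Subset V → Set
  MaxProperModule M =
    IsModule M × Proper M ×
    (∀ N → IsModule N → Proper N →
      (∀ v → M v ≡ true → N v ≡ true) → ∀ v → N v ≡ true → M v ≡ true)

  -- partitions given by a surjective labelling p : V → Fin k
  part : {k : ℕ} → (V → Fin k) → Fin k → Subset V
  part p i v = ⌊ p v ≟ i ⌋

  induced : {k : ℕ} → (p : V → Fin k) → (i : Fin k) →
            Graph (Σ V (λ v → p v ≡ i))
  induced p i = record
    { adj   = λ u v → adj X (proj₁ u) (proj₁ v)
    ; sym   = λ u v → sym X (proj₁ u) (proj₁ v)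
    ; irref = λ v → irref X (proj₁ v) }

  QEdge : {k : ℕ} → (V → Fin k) → Fin k → Fin k → Set
  QEdge p i j = (i ≢ j) × (∀ u v → p u ≡ i → p v ≡ j → adj X u v ≡ true)

  -- the partition prescribed by the modular decomposition
  -- (for a graph that is neither prime nor degenerate)
  UsedPartition : {k : ℕ} → (V → Fin k) → Set
  UsedPartition p =
    (Connected (Edge X) × Connected (CoEdge X) ×
      (∀ i → MaxProperModule (part p i)) ×
      (∀ M → MaxProperModule M → Σ _ (λ i → ∀ v → M v ≡ part p i v)))
    ⊎
    ((¬ Connected (Edge X)) × Connected (CoEdge X) ×
      (∀ u v → (p u ≡ p v → Reach (Edge X) u v) × (Reach (Edge X) u v → p u ≡ p v)))
    ⊎
    (Connected (Edge X) × (¬ Connected (CoEdge X)) ×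
      (∀ u v → (p u ≡ p v → Reach (CoEdge X) u v) × (Reach (CoEdge X) u v → p u ≡ p v)))

-- Trees: vertices with a type (marker = true, normal = false), normal
-- edges (symmetric relation), directed tree edges, and the set of
-- vertices of the root node.

record Tree : Set₁ where
  field
    V      : Set
    marker : V → Bool
    nE     : V → V → Set
    tE     : V → V → Set
    root   : V → Set
open Tree public

baseTree : {V : Set} → Graph V → Tree
baseTree {V} X = record
  { V = V
  ; marker = λ _ → false
  ; nE = λ u v → adj X u v ≡ true
  ; tE = λ _ _ → ⊥
  ; root = λ _ → ⊤ }

data NV (k : ℕ) (Ts : Fin k → Tree) : Set where
  sub : (i : Fin k) → Tree.V (Ts i) → NV k Ts
  mk  : Fin k → NV k Ts                          -- m_i  (quotient)
  mk' : Fin k → NV k Ts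

nvMarker : {k : ℕ} {Ts : Fin k → Tree} → NV k Ts → Bool
nvMarker {Ts = Ts} (sub i x) = Tree.marker (Ts i) x
nvMarker (mk i)  = true
nvMarker (mk' i) = true

data NE {V : Set} (X : Graph V) {k : ℕ} (p : V → Fin k) (Ts : Fin k → Tree)
     : NV k Ts → NV k Ts → Set where
  inSub  : ∀ i x y → Tree.nE (Ts i) x y → NE X p Ts (sub i x) (sub i y)
  inQuot : ∀ i j → QEdge X p i j → NE X p Ts (mk i) (mk j)
  link₁  : ∀ i x → Tree.root (Ts i) x → NE X p Ts (mk' i) (sub i x)
  link₂  : ∀ i x → Tree.root (Ts i) x → NE X p Ts (sub i x) (mk' i)

data TE {k : ℕ} (Ts : Fin k → Tree) : NV k Ts → NV k Ts → Set where
  inSub : ∀ i x y → Tree.tE (Ts i) x y → TE Ts (sub i x) (sub i y)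
  arrow : ∀ i → TE Ts (mk i) (mk' i)

data NRoot {k : ℕ} (Ts : Fin k → Tree) : NV k Ts → Set where
  isRoot : ∀ i → NRoot Ts (mk i)

nodeTree : {V : Set} → (X : Graph V) → {k : ℕ} → (V → Fin k) →
           (Fin k → Tree) → Tree
nodeTree X {k} p Ts = record
  { V = NV k Ts
  ; marker = nvMarker
  ; nE = NE X p Ts
  ; tE = TE Ts
  ; root = NRoot Ts }

data IsModTree : {V : Set} → Graph V → Tree → Set₁ where
  leaf : ∀ {V} (X : Graph V) → Prime X ⊎ Degenerate X →
         IsModTree X (baseTree X)
  node : ∀ {V} (X : Graph V) → ¬ Prime X → ¬ Degenerate X →
         (k : ℕ) (p : V → Fin k) →
         (∀ i → Σ V (λ v → p v ≡ i)) →
         UsedPartition X p →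
         (Ts : Fin k → Tree) →
         (∀ i → IsModTree (induced X p i) (Ts i)) →
         IsModTree X (nodeTree X p Ts)

record GAut {V : Set} (X : Graph V) : Set where
  field
    to   : V → V
    from : V → V
    ft   : ∀ x → from (to x) ≡ x
    tf   : ∀ x → to (from x) ≡ x
    pres : ∀ u v → adj X (to u) (to v) ≡ adj X u v

record TAut (T : Tree) : Set where
  field
    to     : V T → V T
    from   : V T → V T
    ft     : ∀ x → from (to x) ≡ x
    tf     : ∀ x → to (from x) ≡ x
    presM  : ∀ x → marker T (to x) ≡ marker T x
    presN  : ∀ x y → nE T x y → nE T (to x) (to y)
    reflN  : ∀ x y → nE T (to x) (to y) → nE T x y
    presT  : ∀ x y → tE T x y → tE T (to x) (to y)
    reflT  : ∀ x y → tE T (to x) (to y) → tE T x y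

module _ {V : Set} {X : Graph V} where
  open import Relation.Binary.PropositionalEquality using (cong; trans)
  _∘G_ : GAut X → GAut X → GAut X
  f ∘G g = record
    { to = λ x → GAut.to f (GAut.to g x)
    ; from = λ x → GAut.from g (GAut.from f x)
    ; ft = λ x → trans (cong (GAut.from g) (GAut.ft f (GAut.to g x))) (GAut.ft g x)
    ; tf = λ x → trans (cong (GAut.to f) (GAut.tf g (GAut.from f x))) (GAut.tf f x)
    ; pres = λ u v → trans (GAut.pres f (GAut.to g u) (GAut.to g v)) (GAut.pres g u v) }

  _≈G_ : GAut X → GAut X → Set
  f ≈G g = ∀ x → GAut.to f x ≡ GAut.to g x

module _ {T : Tree} where
  open import Relation.Binary.PropositionalEquality using (cong; trans)
  _∘T_ : TAut T → TAut T → TAut T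
  f ∘T g = record
    { to = λ x → TAut.to f (TAut.to g x)
    ; from = λ x → TAut.from g (TAut.from f x)
    ; ft = λ x → trans (cong (TAut.from g) (TAut.ft f (TAut.to g x))) (TAut.ft g x)
    ; tf = λ x → trans (cong (TAut.to f) (TAut.tf g (TAut.from f x))) (TAut.tf f x)
    ; presM = λ x → trans (TAut.presM f (TAut.to g x)) (TAut.presM g x)
    ; presN = λ x y e → TAut.presN f _ _ (TAut.presN g x y e)
    ; reflN = λ x y e → TAut.reflN g x y (TAut.reflN f _ _ e)
    ; presT = λ x y e → TAut.presT f _ _ (TAut.presT g x y e)
    ; reflT = λ x y e → TAut.reflT g x y (TAut.reflT f _ _ e) }

  _≈T_ : TAut T → TAut T → Set
  f ≈T g = ∀ x → TAut.to f x ≡ TAut.to g x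

-- group isomorphism Aut(X) ≅ Aut(T): a well-defined bijective
-- homomorphism (bijective up to the group equality)
record AutIso {V : Set} (X : Graph V) (T : Tree) : Set where
  field
    φ     : GAut X → TAut T
    φ-≈   : ∀ f g → f ≈G g → φ f ≈T φ g
    φ-hom : ∀ f g → φ (f ∘G g) ≈T (φ f ∘T φ g)
    φ-inj : ∀ f g → φ f ≈T φ g → f ≈G g
    φ-sur : ∀ h → Σ (GAut X) (λ f → φ f ≈T h)

-- The isomorphism sends an automorphism of X to the automorphism of T it
-- induces.  More generally, for modular trees d : T of X and d' : T' of
-- Y and any map f : A → B we define a correspondence Corr d d' f between
-- the vertices of T and T', by recursion along the two decompositions
-- (a quotient vertex m_i corresponds to m_j when f sends the block M_i
-- into M'_j).
-- Conversely every tree isomorphism T ≅ T' maps the root node onto the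
-- root node (its vertices are the ones whose normal component is not
-- entered by a tree edge) and each subtree onto a subtree, so by
-- induction it is induced by isomorphisms of the blocks, which glue to
-- an isomorphism X ≅ Y.  Finally the leaves of T represent the vertices
-- of X, which makes the map on automorphisms injective.

module Submission where

open import Axiom.UniquenessOfIdentityProofs.WithK using (uip)
open import Data.Bool using (Bool; true; false)
open import Data.Bool.Properties using (⇔→≡)
open import Data.Empty using (⊥; ⊥-elim)
open import Data.Fin using (Fin; zero; _≟_)
open import Data.Nat using (ℕ; suc)
open import Data.Product using (Σ; _×_; _,_; proj₁; proj₂)
open import Data.Sum using (_⊎_; inj₁; inj₂)
import Data.Sum as Sum
open import Data.Unit using (tt)
open import Function.Bundles using (mk⇔)
open import Relation.Nullary using (¬_; yes; no)
open import Relation.Binary.PropositionalEquality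
  using (_≡_; _≢_; refl; cong; cong₂; trans; subst; subst₂) renaming (sym to ≡-sym)

open import Defs

variable
  A B : Set
  X : Graph A
  Y : Graph B
  T T' : Tree
  k k' : ℕ

-- Points of a fibre of p are equal as soon as their underlying points
-- are: the membership proof is irrelevant by UIP.
fibre-≡ : {p : A → B} {i : B} {a b : A} {e : p a ≡ i} {e' : p b ≡ i} →
          a ≡ b → _≡_ {A = Σ A (λ v → p v ≡ i)} (a , e) (b , e')
fibre-≡ {e = e} {e'} refl = cong (_ ,_) (uip e e')

bool-ext : {a b : Bool} → (a ≡ true → b ≡ true) → (b ≡ true → a ≡ true) → a ≡ b
bool-ext f g = ⇔→≡ (mk⇔ f g)

reach-map : {R : A → A → Set} {S : B → B → Set} (g : A → B) →
            (∀ a b → R a b → S (g a) (g b)) →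
            ∀ {a b} → Reach R a b → Reach S (g a) (g b)
reach-map g m here        = here
reach-map g m (step r rs) = step (m _ _ r) (reach-map g m rs)

_++ʳ_ : {R : A → A → Set} {a b c : A} → Reach R a b → Reach R b c → Reach R a c
here       ++ʳ s = s
step e r   ++ʳ s = step e (r ++ʳ s)

record Iso (X : Graph A) (Y : Graph B) : Set where
  field
    to   : A → B
    from : B → A
    ft   : ∀ x → from (to x) ≡ x
    tf   : ∀ y → to (from y) ≡ y
    pres : ∀ u v → adj Y (to u) (to v) ≡ adj X u v

open Iso

iso⁻¹ : Iso X Y → Iso Y X
iso⁻¹ {Y = Y} f = record
  { to = from f ; from = to f ; ft = tf f ; tf = ft f
  ; pres = λ u v → trans (≡-sym (pres f (from f u) (from f v)))
                         (cong₂ (adj Y) (tf f u) (tf f v)) }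

to-injective : (f : Iso X Y) → ∀ {a b} → to f a ≡ to f b → a ≡ b
to-injective f {a} {b} e = trans (≡-sym (ft f a)) (trans (cong (from f) e) (ft f b))

reach-Edge : (f : Iso X Y) → ∀ {a b} → Reach (Edge X) a b → Reach (Edge Y) (to f a) (to f b)
reach-Edge f = reach-map (to f) (λ a b e → trans (pres f a b) e)

reach-CoEdge : (f : Iso X Y) → ∀ {a b} →
               Reach (CoEdge X) a b → Reach (CoEdge Y) (to f a) (to f b)
reach-CoEdge f = reach-map (to f) λ a b (a≢b , e) →
  (λ q → a≢b (to-injective f q)) , trans (pres f a b) e

connected-Edge : Iso X Y → Connected (Edge X) → Connected (Edge Y)
connected-Edge {Y = Y} f c a b =
  subst₂ (Reach (Edge Y)) (tf f a) (tf f b) (reach-Edge f (c (from f a) (from f b)))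

connected-CoEdge : Iso X Y → Connected (CoEdge X) → Connected (CoEdge Y)
connected-CoEdge {Y = Y} f c a b =
  subst₂ (Reach (CoEdge Y)) (tf f a) (tf f b) (reach-CoEdge f (c (from f a) (from f b)))

module-image : (f : Iso X Y) → ∀ M → IsModule X M → IsModule Y (λ w → M (from f w))
module-image {X = X} {Y = Y} f M ((v , Mv) , outside) =
  (to f v , trans (cong M (ft f v)) Mv) ,
  λ x Mx → Sum.map (transport x) (transport x) (outside (from f x) Mx)
  where
  adj-from : ∀ x m → adj Y x m ≡ adj X (from f x) (from f m)
  adj-from x m = ≡-sym (pres (iso⁻¹ f) x m)
  transport : ∀ {b} x → (∀ m → M m ≡ true → adj X (from f x) m ≡ b) →
              ∀ m → M (from f m) ≡ true → adj Y x m ≡ b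
  transport x all m Mm = trans (adj-from x m) (all _ Mm)

proper-image : (f : Iso X Y) → ∀ M → Proper X M → Proper Y (λ w → M (from f w))
proper-image f M (v , Mv) = to f v , trans (cong M (ft f v)) Mv

trivial-from-preimage : (f : Iso X Y) → ∀ M → Trivial X (λ v → M (to f v)) → Trivial Y M
trivial-from-preimage f M (inj₁ all) = inj₁ λ w → trans (≡-sym (cong M (tf f w))) (all (from f w))
trivial-from-preimage f M (inj₂ (v , Mv , only)) = inj₂ (to f v , Mv , λ w Mw →
  trans (≡-sym (tf f w)) (cong (to f) (only _ (trans (cong M (tf f w)) Mw))))

prime-image : Iso X Y → Prime X → Prime Y
prime-image f prime M isMod =
  trivial-from-preimage f M (prime _ (module-image (iso⁻¹ f) M isMod))

degenerate-image : Iso X Y → Degenerate X → Degenerate Y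
degenerate-image f (inj₁ complete) = inj₁ λ u v u≢v →
  trans (≡-sym (pres (iso⁻¹ f) u v)) (complete _ _ λ e → u≢v (to-injective (iso⁻¹ f) e))
degenerate-image f (inj₂ empty) = inj₂ λ u v → trans (≡-sym (pres (iso⁻¹ f) u v)) (empty _ _)

maxModule-image : (f : Iso X Y) → ∀ M →
                  MaxProperModule X M → MaxProperModule Y (λ w → M (from f w))
maxModule-image f M (isMod , proper , maximal) =
  module-image f M isMod , proper-image f M proper ,
  λ N isModN properN M⊆N v Nv →
    maximal (λ a → N (to f a)) (module-image (iso⁻¹ f) N isModN) (proper-image (iso⁻¹ f) N properN)
            (λ a Ma → M⊆N (to f a) (trans (cong M (ft f a)) Ma))
            (from f v) (trans (cong N (tf f v)) Nv)

module-adj-all : ∀ {M} → IsModule X M → ∀ {x m} → M x ≡ false → M m ≡ true →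
                 adj X x m ≡ true → ∀ m' → M m' ≡ true → adj X x m' ≡ true
module-adj-all (_ , outside) {x} Mx Mm e with outside x Mx
... | inj₁ all  = all
... | inj₂ none with trans (≡-sym e) (none _ Mm)
...   | ()

module Blocks {A : Set} (X : Graph A) {k : ℕ} (p : A → Fin k) where

  inPart : ∀ {i v} → p v ≡ i → part X p i v ≡ true
  inPart {i} {v} e with p v ≟ i
  ... | yes _  = refl
  ... | no p≢i = ⊥-elim (p≢i e)

  notInPart : ∀ {i v} → p v ≢ i → part X p i v ≡ false
  notInPart {i} {v} p≢i with p v ≟ i
  ... | yes e = ⊥-elim (p≢i e)
  ... | no _  = refl

  inPart⁻¹ : ∀ {i v} → part X p i v ≡ true → p v ≡ i
  inPart⁻¹ {i} {v} e with p v ≟ i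
  ... | yes p≡i = p≡i
  ... | no _    with e
  ...   | ()

  moduleBlocks-crossEdge : (∀ i → IsModule X (part X p i)) →
    ∀ u v → p u ≢ p v → adj X u v ≡ true → QEdge X p (p u) (p v)
  moduleBlocks-crossEdge isMod u v pu≢pv uv = pu≢pv , all
    where
    adjacentToBlock : ∀ i {x m} → p x ≢ i → p m ≡ i → adj X x m ≡ true →
                      ∀ m' → p m' ≡ i → adj X x m' ≡ true
    adjacentToBlock i x∉ m∈ xm m' m'∈ =
      module-adj-all {X = X} {M = part X p i} (isMod i) (notInPart x∉) (inPart m∈) xm m' (inPart m'∈)
    all : ∀ u' v' → p u' ≡ p u → p v' ≡ p v → adj X u' v' ≡ true
    all u' v' eu ev = trans (sym X u' v') v'u'
      where
      uv' : adj X u v' ≡ true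
      uv' = adjacentToBlock (p v) pu≢pv refl uv v' ev
      v'u' : adj X v' u' ≡ true
      v'u' = adjacentToBlock (p u) (λ e → pu≢pv (≡-sym (trans (≡-sym ev) e))) refl
               (trans (sym X v' u) uv') u' eu

  coComponents-crossEdge : (∀ u v → Reach (CoEdge X) u v → p u ≡ p v) →
    ∀ u v → p u ≢ p v → adj X u v ≡ true → QEdge X p (p u) (p v)
  coComponents-crossEdge sameBlock u v pu≢pv _ = pu≢pv , all
    where
    all : ∀ u' v' → p u' ≡ p u → p v' ≡ p v → adj X u' v' ≡ true
    all u' v' eu ev with adj X u' v' in uv
    ... | true  = refl
    ... | false = ⊥-elim (pu≢pv (trans (≡-sym eu) (trans (sameBlock u' v' (step coEdge here)) ev)))
      where
      coEdge : CoEdge X u' v'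
      coEdge = (λ u'≡v' → pu≢pv (trans (≡-sym eu) (trans (cong p u'≡v') ev))) , uv

  crossEdge : UsedPartition X p →
    ∀ u v → p u ≢ p v → adj X u v ≡ true → QEdge X p (p u) (p v)
  crossEdge (inj₁ (_ , _ , maxMod , _)) = moduleBlocks-crossEdge (λ i → proj₁ (maxMod i))
  crossEdge (inj₂ (inj₁ (_ , _ , comps))) u v pu≢pv uv =
    ⊥-elim (pu≢pv (proj₂ (comps u v) (step uv here)))
  crossEdge (inj₂ (inj₂ (_ , _ , coComps))) = coComponents-crossEdge (λ u v → proj₂ (coComps u v))

-- An isomorphism X ≅ Y maps each block of the partition used for X
-- into a single block of the partition used for Y: the three kinds of
-- decomposition step are distinguished by (co)connectivity, which is
-- invariant, and each kind of partition is defined invariantly.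
module _ {p : A → Fin k} {q : B → Fin k'} where
  open Blocks

  maxModules-sameBlock : (f : Iso X Y) →
    (∀ i → MaxProperModule X (part X p i)) →
    (∀ M → MaxProperModule Y M → Σ (Fin k') (λ j → ∀ w → M w ≡ part Y q j w)) →
    ∀ u v → p u ≡ p v → q (to f u) ≡ q (to f v)
  maxModules-sameBlock {X = X} {Y = Y} f maxX allMaxY u v pu≡pv =
    trans (inPart⁻¹ Y q (inImage u refl)) (≡-sym (inPart⁻¹ Y q (inImage v (≡-sym pu≡pv))))
    where
    M = part X p (p u)
    image = allMaxY _ (maxModule-image f M (maxX (p u)))
    inImage : ∀ w → p w ≡ p u → part Y q (proj₁ image) (to f w) ≡ true
    inImage w e = trans (≡-sym (proj₂ image (to f w))) (trans (cong M (ft f w)) (inPart X p e))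

  blocks-preserved : (f : Iso X Y) → UsedPartition X p → UsedPartition Y q →
    ∀ u v → p u ≡ p v → q (to f u) ≡ q (to f v)
  blocks-preserved f (inj₁ (_ , _ , maxX , _)) (inj₁ (_ , _ , _ , allMaxY)) =
    maxModules-sameBlock f maxX allMaxY
  blocks-preserved f (inj₂ (inj₁ (_ , _ , compX))) (inj₂ (inj₁ (_ , _ , compY))) u v pu≡pv =
    proj₂ (compY _ _) (reach-Edge f (proj₁ (compX u v) pu≡pv))
  blocks-preserved f (inj₂ (inj₂ (_ , _ , coCompX))) (inj₂ (inj₂ (_ , _ , coCompY))) u v pu≡pv =
    proj₂ (coCompY _ _) (reach-CoEdge f (proj₁ (coCompX u v) pu≡pv))
  blocks-preserved f (inj₁ (conX , _)) (inj₂ (inj₁ (¬conY , _))) =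
    ⊥-elim (¬conY (connected-Edge f conX))
  blocks-preserved f (inj₁ (_ , coConX , _)) (inj₂ (inj₂ (_ , ¬coConY , _))) =
    ⊥-elim (¬coConY (connected-CoEdge f coConX))
  blocks-preserved f (inj₂ (inj₁ (¬conX , _))) (inj₁ (conY , _)) =
    ⊥-elim (¬conX (connected-Edge (iso⁻¹ f) conY))
  blocks-preserved f (inj₂ (inj₁ (¬conX , _))) (inj₂ (inj₂ (conY , _))) =
    ⊥-elim (¬conX (connected-Edge (iso⁻¹ f) conY))
  blocks-preserved f (inj₂ (inj₂ (_ , ¬coConX , _))) (inj₁ (_ , coConY , _)) =
    ⊥-elim (¬coConX (connected-CoEdge (iso⁻¹ f) coConY))
  blocks-preserved f (inj₂ (inj₂ (_ , ¬coConX , _))) (inj₂ (inj₁ (_ , coConY , _))) =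
    ⊥-elim (¬coConX (connected-CoEdge (iso⁻¹ f) coConY))

record SendsBlock (p : A → Fin k) (q : B → Fin k') (f : A → B) (i : Fin k) (j : Fin k') : Set where
  constructor sends
  field into : ∀ v → p v ≡ i → q (f v) ≡ j
open SendsBlock

restrict : {p : A → Fin k} {q : B → Fin k'} {f : A → B} {i : Fin k} {j : Fin k'} →
           SendsBlock p q f i j → Σ A (λ v → p v ≡ i) → Σ B (λ w → q w ≡ j)
restrict {f = f} c (v , e) = f v , into c v e

module _ {p : A → Fin k} {q : B → Fin k'} where

  sendsBlock-unique : {f : A → B} {i : Fin k} {j j' : Fin k'} → Σ A (λ v → p v ≡ i) →
                      SendsBlock p q f i j → SendsBlock p q f i j' → j ≡ j'
  sendsBlock-unique (v , pv) c c' = trans (≡-sym (into c v pv)) (into c' v pv)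

  sendsBlock-comp : {C : Set} {l : ℕ} {r : C → Fin l} {f : A → B} {g : B → C}
                    {i : Fin k} {j : Fin k'} {m : Fin l} →
                    SendsBlock p q f i j → SendsBlock q r g j m → SendsBlock p r (λ a → g (f a)) i m
  sendsBlock-comp c c' = sends λ v pv → into c' _ (into c v pv)

  sendsBlock-resp : {f g : A → B} {i : Fin k} {j : Fin k'} →
                    (∀ a → f a ≡ g a) → SendsBlock p q f i j → SendsBlock p q g i j
  sendsBlock-resp f≗g c = sends λ v pv → trans (cong q (≡-sym (f≗g v))) (into c v pv)

Corr : {A B : Set} {X : Graph A} {Y : Graph B} {T T' : Tree} →
       IsModTree X T → IsModTree Y T' → (A → B) → V T → V T' → Set
Corr (leaf _ _) (leaf _ _) f x y = f x ≡ y
Corr (node _ _ _ _ p _ _ _ _) (node _ _ _ _ q _ _ _ _) f (mk i) (mk j) = SendsBlock p q f i j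
Corr (node _ _ _ _ p _ _ _ _) (node _ _ _ _ q _ _ _ _) f (mk' i) (mk' j) = SendsBlock p q f i j
Corr (node _ _ _ _ p _ _ _ ds) (node _ _ _ _ q _ _ _ ds') f (sub i x) (sub j y) =
  Σ (SendsBlock p q f i j) λ c → Corr (ds i) (ds' j) (restrict c) x y
Corr _ _ _ _ _ = ⊥

corr-resp : {A B : Set} {X : Graph A} {Y : Graph B} {T T' : Tree} →
  (d : IsModTree X T) (d' : IsModTree Y T') {f g : A → B} → (∀ a → f a ≡ g a) →
            ∀ x y → Corr d d' f x y → Corr d d' g x y
corr-resp (leaf _ _) (leaf _ _) f≗g x y c = trans (≡-sym (f≗g x)) c
corr-resp (node _ _ _ _ _ _ _ _ _) (node _ _ _ _ _ _ _ _ _) f≗g (mk i) (mk j) c = sendsBlock-resp f≗g c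
corr-resp (node _ _ _ _ _ _ _ _ _) (node _ _ _ _ _ _ _ _ _) f≗g (mk' i) (mk' j) c = sendsBlock-resp f≗g c
corr-resp (node _ _ _ _ _ _ _ _ ds) (node _ _ _ _ _ _ _ _ ds') f≗g (sub i x) (sub j y) (c , r) =
  sendsBlock-resp f≗g c , corr-resp (ds i) (ds' j) (λ { (v , _) → fibre-≡ (f≗g v) }) x y r

corr-irrelevant : {p : A → Fin k} {q : B → Fin k'} {f : A → B} {i : Fin k} {j : Fin k'}
  {X : Graph (Σ A (λ v → p v ≡ i))} {Y : Graph (Σ B (λ w → q w ≡ j))}
  (d : IsModTree X T) (d' : IsModTree Y T') (c c' : SendsBlock p q f i j) →
  ∀ {x y} → Corr d d' (restrict c) x y → Corr d d' (restrict c') x y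
corr-irrelevant d d' c c' = corr-resp d d' (λ { (_ , _) → fibre-≡ refl }) _ _

-- The correspondence is functional (every block is nonempty).
corr-functional : {A B : Set} {X : Graph A} {Y : Graph B} {T T' : Tree} →
  (d : IsModTree X T) (d' : IsModTree Y T') {f : A → B} →
                  ∀ x y y' → Corr d d' f x y → Corr d d' f x y' → y ≡ y'
corr-functional (leaf _ _) (leaf _ _) x y y' c c' = trans (≡-sym c) c'
corr-functional (node _ _ _ _ _ ne _ _ _) (node _ _ _ _ _ _ _ _ _) (mk i) (mk j) (mk j') c c' =
  cong mk (sendsBlock-unique (ne i) c c')
corr-functional (node _ _ _ _ _ ne _ _ _) (node _ _ _ _ _ _ _ _ _) (mk' i) (mk' j) (mk' j') c c' =
  cong mk' (sendsBlock-unique (ne i) c c')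
corr-functional (node _ _ _ _ _ ne _ _ ds) (node _ _ _ _ _ _ _ _ ds')
  (sub i x) (sub j y) (sub j' y') (c , r) (c' , r')
  with sendsBlock-unique (ne i) c c'
... | refl =
  cong (sub j) (corr-functional (ds i) (ds' j) x y y' r (corr-irrelevant (ds i) (ds' j) c' c r'))

corr-comp : {A B C : Set} {X : Graph A} {Y : Graph B} {Z : Graph C} {T T' T'' : Tree} →
  (d : IsModTree X T) (d' : IsModTree Y T') (d'' : IsModTree Z T'') {f : A → B} {g : B → C} →
            ∀ x y z → Corr d d' f x y → Corr d' d'' g y z → Corr d d'' (λ a → g (f a)) x z
corr-comp (leaf _ _) (leaf _ _) (leaf _ _) {g = g} x y z c c' = trans (cong g c) c'
corr-comp (node _ _ _ _ _ _ _ _ _) (node _ _ _ _ _ _ _ _ _) (node _ _ _ _ _ _ _ _ _)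
  (mk i) (mk j) (mk l) c c' = sendsBlock-comp c c'
corr-comp (node _ _ _ _ _ _ _ _ _) (node _ _ _ _ _ _ _ _ _) (node _ _ _ _ _ _ _ _ _)
  (mk' i) (mk' j) (mk' l) c c' = sendsBlock-comp c c'
corr-comp (node _ _ _ _ _ _ _ _ ds) (node _ _ _ _ _ _ _ _ ds') (node _ _ _ _ _ _ _ _ ds'')
  (sub i x) (sub j y) (sub l z) (c , r) (c' , r') =
  sendsBlock-comp c c' ,
  corr-resp (ds i) (ds'' l) (λ { (_ , _) → fibre-≡ refl }) x z
            (corr-comp (ds i) (ds' j) (ds'' l) x y z r r')

corr-marker : {A B : Set} {X : Graph A} {Y : Graph B} {T T' : Tree} →
  (d : IsModTree X T) (d' : IsModTree Y T') {f : A → B} →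
  ∀ x y → Corr d d' f x y → marker T' y ≡ marker T x
corr-marker (leaf _ _) (leaf _ _) x y c = refl
corr-marker (node _ _ _ _ _ _ _ _ _) (node _ _ _ _ _ _ _ _ _) (mk i) (mk j) c = refl
corr-marker (node _ _ _ _ _ _ _ _ _) (node _ _ _ _ _ _ _ _ _) (mk' i) (mk' j) c = refl
corr-marker (node _ _ _ _ _ _ _ _ ds) (node _ _ _ _ _ _ _ _ ds') (sub i x) (sub j y) (c , r) =
  corr-marker (ds i) (ds' j) x y r

corr-root : {A B : Set} {X : Graph A} {Y : Graph B} {T T' : Tree} →
  (d : IsModTree X T) (d' : IsModTree Y T') {f : A → B} →
  ∀ x y → Corr d d' f x y → root T x → root T' y
corr-root (leaf _ _) (leaf _ _) x y c r = tt
corr-root (node _ _ _ _ _ _ _ _ _) (node _ _ _ _ _ _ _ _ _) (mk i) (mk j) c r = isRoot j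

corr-tE : {A B : Set} {X : Graph A} {Y : Graph B} {T T' : Tree} →
  (d : IsModTree X T) (d' : IsModTree Y T') {f : A → B} →
  ∀ x x' y y' → Corr d d' f x y → Corr d d' f x' y' → tE T x x' → tE T' y y'
corr-tE (node _ _ _ _ _ ne _ _ ds) (node _ _ _ _ _ _ _ _ ds')
  (sub i a) (sub i b) (sub j ya) (sub j' yb) (c , r) (c' , r') (inSub i a b e)
  with sendsBlock-unique (ne i) c c'
... | refl =
  inSub j ya yb (corr-tE (ds i) (ds' j) a b ya yb r (corr-irrelevant (ds i) (ds' j) c' c r') e)
corr-tE (node _ _ _ _ _ ne _ _ _) (node _ _ _ _ _ _ _ _ _) (mk i) (mk' i) (mk j) (mk' j') c c' (arrow i)
  with sendsBlock-unique (ne i) c c'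
... | refl = arrow j

module BlockAction {X : Graph A} {Y : Graph B} {p : A → Fin k} {q : B → Fin k'}
  (f : Iso X Y) (nonempty : ∀ i → Σ A (λ v → p v ≡ i))
  (usedX : UsedPartition X p) (usedY : UsedPartition Y q) where

  blockImage : Fin k → Fin k'
  blockImage i = q (to f (proj₁ (nonempty i)))

  sends-blockImage : ∀ i → SendsBlock p q (to f) i (blockImage i)
  sends-blockImage i = sends λ v pv →
    blocks-preserved f usedX usedY v _ (trans pv (≡-sym (proj₂ (nonempty i))))

  sends-inverse : ∀ {i j} → SendsBlock p q (to f) i j → SendsBlock q p (from f) j i
  sends-inverse {i} c = sends λ w qw →
    trans (blocks-preserved (iso⁻¹ f) usedY usedX w (to f a) (trans qw (≡-sym (into c a pa))))
          (trans (cong p (ft f a)) pa)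
    where
    a = proj₁ (nonempty i)
    pa = proj₂ (nonempty i)

  blockIso : ∀ {i j} → SendsBlock p q (to f) i j → Iso (induced X p i) (induced Y q j)
  blockIso c = record
    { to = restrict c
    ; from = restrict (sends-inverse c)
    ; ft = λ { (v , _) → fibre-≡ (ft f v) }
    ; tf = λ { (w , _) → fibre-≡ (tf f w) }
    ; pres = λ { (u , _) (v , _) → pres f u v } }

  quotientEdge-image : ∀ {i i' j j'} → SendsBlock p q (to f) i j → SendsBlock p q (to f) i' j' →
                       QEdge X p i i' → QEdge Y q j j'
  quotientEdge-image {i} {i'} {j} {j'} c c' (i≢i' , full) = j≢j' , λ u v qu qv →
      trans (≡-sym (pres (iso⁻¹ f) u v)) (full _ _ (into c⁻¹ u qu) (into c'⁻¹ v qv))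
    where
    c⁻¹ = sends-inverse c
    c'⁻¹ = sends-inverse c'
    v' = proj₂ (nonempty i')
    j≢j' : j ≢ j'
    j≢j' j≡j' = i≢i' (trans (≡-sym (into c⁻¹ _ (trans (into c' _ v') (≡-sym j≡j'))))
                            (into c'⁻¹ _ (into c' _ v')))

-- Being prime or degenerate is invariant, so isomorphic graphs are both
-- leaves or both inner nodes of their decompositions.
leaf-vs-node : Iso X Y → Prime X ⊎ Degenerate X → ¬ Prime Y → ¬ Degenerate Y → ⊥
leaf-vs-node f (inj₁ prime) ¬prime _ = ¬prime (prime-image f prime)
leaf-vs-node f (inj₂ deg)   _ ¬deg   = ¬deg (degenerate-image f deg)

corr-total : {A B : Set} {X : Graph A} {Y : Graph B} {T T' : Tree} →
  (f : Iso X Y) (d : IsModTree X T) (d' : IsModTree Y T') →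
  ∀ x → Σ (V T') (Corr d d' (to f) x)
corr-total f (leaf _ _) (leaf _ _) x = to f x , refl
corr-total f (leaf _ pd) (node _ ¬prime ¬deg _ _ _ _ _ _) x =
  ⊥-elim (leaf-vs-node f pd ¬prime ¬deg)
corr-total f (node _ ¬prime ¬deg _ _ _ _ _ _) (leaf _ pd) x =
  ⊥-elim (leaf-vs-node (iso⁻¹ f) pd ¬prime ¬deg)
corr-total f (node _ _ _ _ _ ne up _ _) (node _ _ _ _ _ _ up' _ _) (mk i) =
  mk _ , BlockAction.sends-blockImage f ne up up' i
corr-total f (node _ _ _ _ _ ne up _ _) (node _ _ _ _ _ _ up' _ _) (mk' i) =
  mk' _ , BlockAction.sends-blockImage f ne up up' i
corr-total f (node _ _ _ _ _ ne up _ ds) (node _ _ _ _ _ _ up' _ ds') (sub i x) =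
  sub _ (proj₁ inBlock) , c , proj₂ inBlock
  where
  c = BlockAction.sends-blockImage f ne up up' i
  inBlock = corr-total (BlockAction.blockIso f ne up up' c) (ds i) (ds' _) x

corr-inverse : {A B : Set} {X : Graph A} {Y : Graph B} {T T' : Tree} →
  (f : Iso X Y) (d : IsModTree X T) (d' : IsModTree Y T') →
  ∀ x y → Corr d d' (to f) x y → Corr d' d (from f) y x
corr-inverse f (leaf _ _) (leaf _ _) x y c = trans (cong (from f) (≡-sym c)) (ft f x)
corr-inverse f (node _ _ _ _ _ ne up _ _) (node _ _ _ _ _ _ up' _ _) (mk i) (mk j) c =
  BlockAction.sends-inverse f ne up up' c
corr-inverse f (node _ _ _ _ _ ne up _ _) (node _ _ _ _ _ _ up' _ _) (mk' i) (mk' j) c =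
  BlockAction.sends-inverse f ne up up' c
corr-inverse f (node _ _ _ _ _ ne up _ ds) (node _ _ _ _ _ _ up' _ ds') (sub i x) (sub j y) (c , r) =
  BlockAction.sends-inverse f ne up up' c ,
  corr-inverse (BlockAction.blockIso f ne up up' c) (ds i) (ds' j) x y r

corr-nE : {A B : Set} {X : Graph A} {Y : Graph B} {T T' : Tree} →
  (f : Iso X Y) (d : IsModTree X T) (d' : IsModTree Y T') →
  ∀ x x' y y' → Corr d d' (to f) x y → Corr d d' (to f) x' y' → nE T x x' → nE T' y y'
corr-nE {Y = Y} f (leaf _ _) (leaf _ _) x x' y y' c c' e =
  trans (cong₂ (adj Y) (≡-sym c) (≡-sym c')) (trans (pres f x x') e)
corr-nE f (node _ _ _ _ _ ne up _ ds) (node _ _ _ _ _ _ up' _ ds')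
  (sub i a) (sub i b) (sub j ya) (sub j' yb) (c , r) (c' , r') (inSub i a b e)
  with sendsBlock-unique (ne i) c c'
... | refl = inSub j ya yb (corr-nE (BlockAction.blockIso f ne up up' c) (ds i) (ds' j) a b ya yb r
                              (corr-irrelevant (ds i) (ds' j) c' c r') e)
corr-nE f (node _ _ _ _ _ ne up _ _) (node _ _ _ _ _ _ up' _ _)
  (mk i) (mk i') (mk j) (mk j') c c' (inQuot i i' qe) =
  inQuot j j' (BlockAction.quotientEdge-image f ne up up' c c' qe)
corr-nE f (node _ _ _ _ _ ne _ _ ds) (node _ _ _ _ _ _ _ _ ds')
  (mk' i) (sub i a) (mk' j) (sub j' yb) c (c' , r') (link₁ i a ra)
  with sendsBlock-unique (ne i) c c'
... | refl = link₁ j yb (corr-root (ds i) (ds' j) a yb r' ra)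
corr-nE f (node _ _ _ _ _ ne _ _ ds) (node _ _ _ _ _ _ _ _ ds')
  (sub i a) (mk' i) (sub j ya) (mk' j') (c , r) c' (link₂ i a ra)
  with sendsBlock-unique (ne i) c c'
... | refl = link₂ j ya (corr-root (ds i) (ds' j) a ya r ra)

record TIso (T T' : Tree) : Set where
  field
    to     : V T → V T'
    from   : V T' → V T
    ft     : ∀ x → from (to x) ≡ x
    tf     : ∀ x → to (from x) ≡ x
    presM  : ∀ x → marker T' (to x) ≡ marker T x
    presN  : ∀ x y → nE T x y → nE T' (to x) (to y)
    reflN  : ∀ x y → nE T' (to x) (to y) → nE T x y
    presT  : ∀ x y → tE T x y → tE T' (to x) (to y)
    reflT  : ∀ x y → tE T' (to x) (to y) → tE T x y

tiso⁻¹ : TIso T T' → TIso T' T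
tiso⁻¹ {T' = T'} h = record
  { to = H.from ; from = H.to ; ft = H.tf ; tf = H.ft
  ; presM = λ x → trans (≡-sym (H.presM (H.from x))) (cong (marker T') (H.tf x))
  ; presN = λ x y e → H.reflN (H.from x) (H.from y) (subst₂ (nE T') (≡-sym (H.tf x)) (≡-sym (H.tf y)) e)
  ; reflN = λ x y e → subst₂ (nE T') (H.tf x) (H.tf y) (H.presN _ _ e)
  ; presT = λ x y e → H.reflT (H.from x) (H.from y) (subst₂ (tE T') (≡-sym (H.tf x)) (≡-sym (H.tf y)) e)
  ; reflT = λ x y e → subst₂ (tE T') (H.tf x) (H.tf y) (H.presT _ _ e) }
  where module H = TIso h

transpose : (h : TIso T T') → ∀ {x y} → TIso.to h x ≡ y → x ≡ TIso.from h y
transpose h {x} e = trans (≡-sym (TIso.ft h x)) (cong (TIso.from h) e)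

-- The tree isomorphism induced by a graph isomorphism: the
-- correspondence along f, which is a bijection since its converse is the
-- correspondence along the inverse of f.
module _ {A B : Set} {X : Graph A} {Y : Graph B} {T T' : Tree}
  (f : Iso X Y) (d : IsModTree X T) (d' : IsModTree Y T') where

  induced-to : V T → V T'
  induced-to x = proj₁ (corr-total f d d' x)

  induced-corr : ∀ x → Corr d d' (to f) x (induced-to x)
  induced-corr x = proj₂ (corr-total f d d' x)

  inducedTreeIso : TIso T T'
  inducedTreeIso = record
    { to = induced-to
    ; from = from⁻
    ; ft = λ x → corr-functional d' d (induced-to x) _ _ (corr⁻ _) (back x)
    ; tf = λ y → corr-functional d d' (from⁻ y) _ _ (induced-corr _)
                   (corr-inverse (iso⁻¹ f) d' d y _ (corr⁻ y))
    ; presM = λ x → corr-marker d d' x _ (induced-corr x)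
    ; presN = λ x x' → corr-nE f d d' x x' _ _ (induced-corr x) (induced-corr x')
    ; reflN = λ x x' → corr-nE (iso⁻¹ f) d' d _ _ x x' (back x) (back x')
    ; presT = λ x x' → corr-tE d d' x x' _ _ (induced-corr x) (induced-corr x')
    ; reflT = λ x x' → corr-tE d' d _ _ x x' (back x) (back x') }
    where
    from⁻ : V T' → V T
    from⁻ y = proj₁ (corr-total (iso⁻¹ f) d' d y)
    corr⁻ : ∀ y → Corr d' d (from f) y (from⁻ y)
    corr⁻ y = proj₂ (corr-total (iso⁻¹ f) d' d y)
    back : ∀ x → Corr d' d (from f) (induced-to x) x
    back x = corr-inverse f d d' x _ (induced-corr x)

UE : (T : Tree) → V T → V T → Set
UE T a b = nE T a b ⊎ nE T b a ⊎ tE T a b ⊎ tE T b a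

-- In a
-- modular tree this fails exactly for the vertices of the root node,
-- which is how a tree isomorphism is seen to fix the root node.
Entered : (T : Tree) → V T → Set
Entered T x = Σ (V T) λ w → Reach (nE T) x w × Σ (V T) λ u → tE T u w

module _ (h : TIso T T') where
  private module H = TIso h

  entered-preimage : ∀ {x} → Entered T' (H.to x) → Entered T x
  entered-preimage {x} (w , r , u , te) =
    H.from w ,
    subst (λ z → Reach (nE T) z (H.from w)) (H.ft x) (reach-map H.from (TIso.presN (tiso⁻¹ h)) r) ,
    H.from u , TIso.presT (tiso⁻¹ h) u w te

  ue-image : ∀ {a b} → UE T a b → UE T' (H.to a) (H.to b)
  ue-image (inj₁ e)                = inj₁ (H.presN _ _ e)
  ue-image (inj₂ (inj₁ e))         = inj₂ (inj₁ (H.presN _ _ e))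
  ue-image (inj₂ (inj₂ (inj₁ e)))  = inj₂ (inj₂ (inj₁ (H.presT _ _ e)))
  ue-image (inj₂ (inj₂ (inj₂ e)))  = inj₂ (inj₂ (inj₂ (H.presT _ _ e)))

mk-injective : ∀ {l} {Us : Fin l → Tree} {a b} → _≡_ {A = NV l Us} (mk a) (mk b) → a ≡ b
mk-injective refl = refl

sub-injective : ∀ {l} {Us : Fin l → Tree} {i} {a b : V (Us i)} →
                _≡_ {A = NV l Us} (sub i a) (sub i b) → a ≡ b
sub-injective refl = refl

neSub : {X : Graph A} {p : A → Fin k} {Ts : Fin k → Tree} {i : Fin k} {a b : V (Ts i)} →
        NE X p Ts (sub i a) (sub i b) → nE (Ts i) a b
neSub (inSub _ _ _ e) = e

neQuot : {X : Graph A} {p : A → Fin k} {Ts : Fin k → Tree} {i j : Fin k} →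
         NE X p Ts (mk i) (mk j) → QEdge X p i j
neQuot (inQuot _ _ qe) = qe

teSub : {Ts : Fin k → Tree} {i : Fin k} {a b : V (Ts i)} → TE Ts (sub i a) (sub i b) → tE (Ts i) a b
teSub (inSub _ _ _ e) = e

module Composite {A : Set} (X : Graph A) {k : ℕ} (p : A → Fin k) (Ts : Fin k → Tree) where
  private TT = nodeTree X p Ts

  sub-reach : ∀ i {a b} → Reach (nE (Ts i)) a b → Reach (nE TT) (sub i a) (sub i b)
  sub-reach i = reach-map (sub i) (inSub i)

  sub-ue : ∀ i {a b} → UE (Ts i) a b → UE TT (sub i a) (sub i b)
  sub-ue i (inj₁ e)                = inj₁ (inSub i _ _ e)
  sub-ue i (inj₂ (inj₁ e))         = inj₂ (inj₁ (inSub i _ _ e))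
  sub-ue i (inj₂ (inj₂ (inj₁ e)))  = inj₂ (inj₂ (inj₁ (inSub i _ _ e)))
  sub-ue i (inj₂ (inj₂ (inj₂ e)))  = inj₂ (inj₂ (inj₂ (inSub i _ _ e)))

  -- The normal edges at the root node stay inside the root node and no
  -- tree edge enters it.
  mk-notEntered : ∀ i → ¬ Entered TT (mk i)
  mk-notEntered i (w , r , u , te) = noTreeEdgeInto (stays r) te
    where
    stays : ∀ {i w} → Reach (nE TT) (mk i) w → Σ (Fin k) λ j → w ≡ mk j
    stays {i} here = i , refl
    stays (step (inQuot _ _ _) r) = stays r
    noTreeEdgeInto : ∀ {u w} → Σ (Fin k) (λ j → w ≡ mk j) → ¬ TE Ts u w
    noTreeEdgeInto (_ , refl) ()

  mk'-entered : ∀ j → Entered TT (mk' j)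
  mk'-entered j = mk' j , here , mk j , arrow j

  -- A vertex of a subtree that is entered, or at the root of T_i (hence
  -- adjacent to m_i'), is entered in the composite tree.
  sub-entered : ∀ i x → root (Ts i) x ⊎ Entered (Ts i) x → Entered TT (sub i x)
  sub-entered i x (inj₁ r) = mk' i , step (link₂ i x r) here , mk i , arrow i
  sub-entered i x (inj₂ (w , rw , u , te)) = sub i w , sub-reach i rw , sub i u , inSub i u w te

root-or-entered : {X : Graph A} → IsModTree X T → ∀ x → root T x ⊎ Entered T x
root-or-entered (leaf _ _) x = inj₁ tt
root-or-entered (node _ _ _ _ _ _ _ _ ds) (mk i) = inj₁ (isRoot i)
root-or-entered (node X _ _ _ p _ _ Ts _) (mk' i) = inj₂ (Composite.mk'-entered X p Ts i)
root-or-entered (node X _ _ _ p _ _ Ts ds) (sub i x) =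
  inj₂ (Composite.sub-entered X p Ts i x (root-or-entered (ds i) x))

path-to-root : {X : Graph A} → IsModTree X T → ∀ x → Σ (V T) λ r → root T r × Reach (UE T) x r
path-to-root (leaf _ _) x = x , tt , here
path-to-root (node _ _ _ _ _ _ _ _ ds) (mk i) = mk i , isRoot i , here
path-to-root (node _ _ _ _ _ _ _ _ ds) (mk' i) =
  mk i , isRoot i , step (inj₂ (inj₂ (inj₂ (arrow i)))) here
path-to-root (node X _ _ _ p _ _ Ts ds) (sub i x) with path-to-root (ds i) x
... | r , root-r , path =
  mk i , isRoot i ,
  (reach-map (sub i) (λ _ _ → Composite.sub-ue X p Ts i) path ++ʳ
   step (inj₁ (link₂ i r root-r)) (step (inj₂ (inj₂ (inj₂ (arrow i)))) here))

-- A tree isomorphism h between two composite modular trees.  First, h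
-- maps the root node onto the root node, m_i ↦ m_π(i), and then
-- m_i' ↦ m_π(i)' along the tree edge m_i → m_i'.
module RootImage {X : Graph A} {Y : Graph B} {p : A → Fin k} {q : B → Fin k'}
  {Ts : Fin k → Tree} {Ts' : Fin k' → Tree}
  (ds' : ∀ j → IsModTree (induced Y q j) (Ts' j))
  (h : TIso (nodeTree X p Ts) (nodeTree Y q Ts')) where
  private module H = TIso h

  private
    module CX = Composite X p Ts
    module CY = Composite Y q Ts'

  image-notEntered : ∀ i z → H.to (mk i) ≡ z → ¬ Entered (nodeTree Y q Ts') z
  image-notEntered i _ refl e = CX.mk-notEntered i (entered-preimage h e)

  rootImage : ∀ i → Σ (Fin k') λ j → H.to (mk i) ≡ mk j
  rootImage i with H.to (mk i) in eq
  ... | mk j    = j , refl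
  ... | mk' j   = ⊥-elim (image-notEntered i _ eq (CY.mk'-entered j))
  ... | sub j y = ⊥-elim (image-notEntered i _ eq (CY.sub-entered j y (root-or-entered (ds' j) y)))

  π : Fin k → Fin k'
  π i = proj₁ (rootImage i)

  π-mk : ∀ i → H.to (mk i) ≡ mk (π i)
  π-mk i = proj₂ (rootImage i)

  π-mk' : ∀ i → H.to (mk' i) ≡ mk' (π i)
  π-mk' i = arrowTarget (subst (λ z → TE Ts' z (H.to (mk' i))) (π-mk i) (H.presT _ _ (arrow i)))
    where
    arrowTarget : ∀ {j z} → TE Ts' (mk j) z → z ≡ mk' j
    arrowTarget (arrow j) = refl

-- Next, h maps each subtree T_i into T_π(i): a vertex of T_i is joined
-- to m_i' by a path avoiding the root node and the m_l', the image of
-- this path avoids them too (they are images of such vertices), and a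
-- step from a vertex of T'_j to a vertex outside them stays in T'_j.
module SubtreeImage {X : Graph A} {Y : Graph B} {p : A → Fin k} {q : B → Fin k'}
  {Ts : Fin k → Tree} {Ts' : Fin k' → Tree}
  (ds : ∀ i → IsModTree (induced X p i) (Ts i)) (ds' : ∀ j → IsModTree (induced Y q j) (Ts' j))
  (h : TIso (nodeTree X p Ts) (nodeTree Y q Ts')) where
  private
    module H = TIso h
    module R⁻ = RootImage ds (tiso⁻¹ h)
  open RootImage ds' h using (π; π-mk; π-mk')

  sub-not-mk : ∀ i x l → H.to (sub i x) ≢ mk l
  sub-not-mk i x l e with trans (transpose h e) (R⁻.π-mk l)
  ... | ()

  sub-not-mk' : ∀ i x l → H.to (sub i x) ≢ mk' l
  sub-not-mk' i x l e with trans (transpose h e) (R⁻.π-mk' l)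
  ... | ()

  stays-in-subtree : ∀ {j y} z → (∀ l → z ≢ mk l) → (∀ l → z ≢ mk' l) →
                     UE (nodeTree Y q Ts') z (sub j y) → Σ (V (Ts' j)) λ y' → z ≡ sub j y'
  stays-in-subtree _ _ _   (inj₁ (inSub j y' y _))                = y' , refl
  stays-in-subtree _ _ ¬mk' (inj₁ (link₁ j y _))                  = ⊥-elim (¬mk' j refl)
  stays-in-subtree _ _ _   (inj₂ (inj₁ (inSub j y y' _)))         = y' , refl
  stays-in-subtree _ _ ¬mk' (inj₂ (inj₁ (link₂ j y _)))           = ⊥-elim (¬mk' j refl)
  stays-in-subtree _ _ _   (inj₂ (inj₂ (inj₁ (inSub j y' y _))))  = y' , refl
  stays-in-subtree _ _ _   (inj₂ (inj₂ (inj₂ (inSub j y y' _))))  = y' , refl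

  subtreeImage : ∀ i x → Σ (V (Ts' (π i))) λ y → H.to (sub i x) ≡ sub (π i) y
  subtreeImage i x with path-to-root (ds i) x
  ... | r , root-r , path = along path
    where
    linkSource : ∀ {j} z → NE Y q Ts' z (mk' j) → Σ (V (Ts' j)) λ y → z ≡ sub j y
    linkSource _ (link₂ j y _) = y , refl
    along : ∀ {a} → Reach (UE (Ts i)) a r → Σ (V (Ts' (π i))) λ y → H.to (sub i a) ≡ sub (π i) y
    along here =
      linkSource _ (subst (NE Y q Ts' (H.to (sub i r))) (π-mk' i) (H.presN _ _ (link₂ i r root-r)))
    along {a} (step e rest) =
      stays-in-subtree (H.to (sub i a)) (sub-not-mk i a) (sub-not-mk' i a)
        (subst (UE (nodeTree Y q Ts') (H.to (sub i a))) (proj₂ (along rest))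
               (ue-image h (Composite.sub-ue X p Ts i e)))

module SubtreeIso {X : Graph A} {Y : Graph B} {p : A → Fin k} {q : B → Fin k'}
  {Ts : Fin k → Tree} {Ts' : Fin k' → Tree}
  (ds : ∀ i → IsModTree (induced X p i) (Ts i)) (ds' : ∀ j → IsModTree (induced Y q j) (Ts' j))
  (h : TIso (nodeTree X p Ts) (nodeTree Y q Ts')) where
  private
    module H = TIso h
    module R⁻ = RootImage ds (tiso⁻¹ h)
    module S⁻ = SubtreeImage ds' ds (tiso⁻¹ h)
  open RootImage ds' h using (π; π-mk; π-mk') public
  open SubtreeImage ds ds' h using (subtreeImage) public
  open R⁻ using () renaming (π to π⁻) public

  π⁻-π : ∀ i → π⁻ (π i) ≡ i
  π⁻-π i = mk-injective (≡-sym (trans (transpose h (π-mk i)) (R⁻.π-mk (π i))))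

  π-π⁻ : ∀ j → π (π⁻ j) ≡ j
  π-π⁻ j = mk-injective (≡-sym (trans (transpose (tiso⁻¹ h) (R⁻.π-mk j)) (π-mk (π⁻ j))))

  subtreePreimage : ∀ i y → Σ (V (Ts i)) λ x → H.from (sub (π i) y) ≡ sub i x
  subtreePreimage i y with π⁻ (π i) | π⁻-π i | S⁻.subtreeImage (π i) y
  ... | _ | refl | r = r

  subtreeIso : ∀ i → TIso (Ts i) (Ts' (π i))
  subtreeIso i = record
    { to = down
    ; from = up
    ; ft = λ x → sub-injective (≡-sym (trans (transpose h (down-eq x)) (up-eq _)))
    ; tf = λ y → sub-injective (≡-sym (trans (transpose (tiso⁻¹ h) (up-eq y)) (down-eq _)))
    ; presM = λ x → trans (cong (marker (nodeTree Y q Ts')) (≡-sym (down-eq x))) (H.presM (sub i x))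
    ; presN = λ a b e → neSub (image-as-sub (NE Y q Ts') (H.presN _ _ (inSub i a b e)))
    ; reflN = λ a b e → neSub (H.reflN _ _ (sub-as-image (NE Y q Ts') (inSub (π i) _ _ e)))
    ; presT = λ a b e → teSub (image-as-sub (TE Ts') (H.presT _ _ (inSub i a b e)))
    ; reflT = λ a b e → teSub (H.reflT _ _ (sub-as-image (TE Ts') (inSub (π i) _ _ e))) }
    where
    down : V (Ts i) → V (Ts' (π i))
    down x = proj₁ (subtreeImage i x)
    down-eq : ∀ x → H.to (sub i x) ≡ sub (π i) (down x)
    down-eq x = proj₂ (subtreeImage i x)
    up : V (Ts' (π i)) → V (Ts i)
    up y = proj₁ (subtreePreimage i y)
    up-eq : ∀ y → H.from (sub (π i) y) ≡ sub i (up y)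
    up-eq y = proj₂ (subtreePreimage i y)
    image-as-sub : ∀ (R : V (nodeTree Y q Ts') → V (nodeTree Y q Ts') → Set) {a b} →
             R (H.to (sub i a)) (H.to (sub i b)) → R (sub (π i) (down a)) (sub (π i) (down b))
    image-as-sub R {a} {b} = subst₂ R (down-eq a) (down-eq b)
    sub-as-image : ∀ (R : V (nodeTree Y q Ts') → V (nodeTree Y q Ts') → Set) {a b} →
               R (sub (π i) (down a)) (sub (π i) (down b)) → R (H.to (sub i a)) (H.to (sub i b))
    sub-as-image R {a} {b} = subst₂ R (≡-sym (down-eq a)) (≡-sym (down-eq b))

-- Finally, given isomorphisms g_i : X[M_i] ≅ Y[M'_π(i)] whose induced
-- tree isomorphisms are the restrictions of h, the g_i glue to an
-- isomorphism X ≅ Y inducing h: inside a block it is some g_i, and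
-- between blocks adjacency is read off the quotient, which h preserves.
module GlueIso {X : Graph A} {Y : Graph B} {p : A → Fin k} {q : B → Fin k'}
  {Ts : Fin k → Tree} {Ts' : Fin k' → Tree}
  (usedX : UsedPartition X p) (usedY : UsedPartition Y q)
  (ds : ∀ i → IsModTree (induced X p i) (Ts i)) (ds' : ∀ j → IsModTree (induced Y q j) (Ts' j))
  (h : TIso (nodeTree X p Ts) (nodeTree Y q Ts'))
  (g : ∀ i → Iso (induced X p i) (induced Y q (SubtreeIso.π ds ds' h i))) where
  private module H = TIso h
  open SubtreeIso ds ds' h

  glued : A → B
  glued v = proj₁ (to (g (p v)) (v , refl))

  glued-block : ∀ v → q (glued v) ≡ π (p v)
  glued-block v = proj₂ (to (g (p v)) (v , refl))

  glued-at : ∀ i v (e : p v ≡ i) → glued v ≡ proj₁ (to (g i) (v , e))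
  glued-at _ v refl = refl

  sends-π : ∀ i → SendsBlock p q glued i (π i)
  sends-π i = sends λ v e → trans (cong q (glued-at i v e)) (proj₂ (to (g i) (v , e)))

  unglued : B → A
  unglued w = proj₁ (from (g (π⁻ (q w))) (w , ≡-sym (π-π⁻ (q w))))

  unglued-at : ∀ i w (e : q w ≡ π i) → unglued w ≡ proj₁ (from (g i) (w , e))
  unglued-at i w e = same-block (trans (cong π⁻ e) (π⁻-π i)) _ e
    where
    same-block : ∀ {i'} → π⁻ (q w) ≡ i' → ∀ e e' →
                 proj₁ (from (g (π⁻ (q w))) (w , e)) ≡ proj₁ (from (g i') (w , e'))
    same-block refl e e' = cong (λ e → proj₁ (from (g _) (w , e))) (uip e e')

  unglued-glued : ∀ v → unglued (glued v) ≡ v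
  unglued-glued v =
    trans (unglued-at (p v) (glued v) (glued-block v)) (cong proj₁ (ft (g (p v)) (v , refl)))

  glued-unglued : ∀ w → glued (unglued w) ≡ w
  glued-unglued w = trans (glued-at _ (proj₁ b) (proj₂ b)) (cong proj₁ (tf (g _) (w , e)))
    where
    e = ≡-sym (π-π⁻ (q w))
    b = from (g (π⁻ (q w))) (w , e)

  crossEdge-to : ∀ u v → p u ≢ p v → adj X u v ≡ true → adj Y (glued u) (glued v) ≡ true
  crossEdge-to u v pu≢pv uv = proj₂ (neQuot imageEdge) _ _ (glued-block u) (glued-block v)
    where
    imageEdge : NE Y q Ts' (mk (π (p u))) (mk (π (p v)))
    imageEdge = subst₂ (NE Y q Ts') (π-mk _) (π-mk _)
                  (H.presN _ _ (inQuot _ _ (Blocks.crossEdge X p usedX u v pu≢pv uv)))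

  crossEdge-from : ∀ u v → p u ≢ p v → adj Y (glued u) (glued v) ≡ true → adj X u v ≡ true
  crossEdge-from u v pu≢pv e = proj₂ (neQuot {X = X} (H.reflN _ _ imageEdge)) u v refl refl
    where
    πpu≢πpv : π (p u) ≢ π (p v)
    πpu≢πpv e = pu≢pv (trans (≡-sym (π⁻-π _)) (trans (cong π⁻ e) (π⁻-π _)))
    qe = Blocks.crossEdge Y q usedY (glued u) (glued v)
           (λ e → πpu≢πpv (trans (≡-sym (glued-block u)) (trans e (glued-block v)))) e
    imageEdge : NE Y q Ts' (H.to (mk (p u))) (H.to (mk (p v)))
    imageEdge = subst₂ (NE Y q Ts') (≡-sym (π-mk _)) (≡-sym (π-mk _))
                  (inQuot _ _ (subst₂ (QEdge Y q) (glued-block u) (glued-block v) qe))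

  glued-pres : ∀ u v → adj Y (glued u) (glued v) ≡ adj X u v
  glued-pres u v with p u ≟ p v
  ... | yes e    = trans (cong (λ z → adj Y z (glued v)) (glued-at (p v) u e))
                         (pres (g (p v)) (u , e) (v , refl))
  ... | no pu≢pv = bool-ext (crossEdge-from u v pu≢pv) (crossEdge-to u v pu≢pv)

  gluedIso : Iso X Y
  gluedIso = record
    { to = glued
    ; from = unglued
    ; ft = unglued-glued
    ; tf = glued-unglued
    ; pres = glued-pres }

  glued-corr : (¬primeX : ¬ Prime X) (¬degX : ¬ Degenerate X) (neX : ∀ i → Σ A (λ v → p v ≡ i))
               (¬primeY : ¬ Prime Y) (¬degY : ¬ Degenerate Y) (neY : ∀ j → Σ B (λ w → q w ≡ j)) →
               (∀ i x → Corr (ds i) (ds' (π i)) (to (g i)) x (TIso.to (subtreeIso i) x)) →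
               ∀ x → Corr (node X ¬primeX ¬degX k p neX usedX Ts ds)
                          (node Y ¬primeY ¬degY k' q neY usedY Ts' ds') glued x (H.to x)
  glued-corr _ _ _ _ _ _ _ (mk i) = subst (Corr _ _ glued (mk i)) (≡-sym (π-mk i)) (sends-π i)
  glued-corr _ _ _ _ _ _ _ (mk' i) = subst (Corr _ _ glued (mk' i)) (≡-sym (π-mk' i)) (sends-π i)
  glued-corr _ _ _ _ _ _ g-corr (sub i x) =
    subst (Corr _ _ glued (sub i x)) (≡-sym (proj₂ (subtreeImage i x)))
      (sends-π i , corr-resp (ds i) (ds' (π i)) g≗restrict x _ (g-corr i x))
    where
    g≗restrict : ∀ a → to (g i) a ≡ restrict (sends-π i) a
    g≗restrict (v , e) = fibre-≡ (≡-sym (glued-at i v e))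

-- A graph that is not prime has a vertex, so any labelling of its
-- vertices uses some label.
someLabel : {X : Graph A} → ¬ Prime X → (A → Fin k) → Fin k
someLabel {k = suc _} _ _ = zero
someLabel {k = ℕ.zero} ¬prime p =
  ⊥-elim (¬prime λ M isMod → ⊥-elim (noLabel (p (proj₁ (proj₁ isMod)))))
  where
  noLabel : Fin 0 → ⊥
  noLabel ()

-- Every isomorphism of modular trees is induced by a graph isomorphism:
-- at leaf nodes it is one, a leaf and an inner node are never isomorphic
-- (only the latter has tree edges), and at inner nodes the isomorphisms
-- of the subtrees, obtained by induction, glue together.
treeIso-induced : {A B : Set} {X : Graph A} {Y : Graph B} {T T' : Tree} →
  (d : IsModTree X T) (d' : IsModTree Y T') (h : TIso T T') →
  Σ (Iso X Y) λ f → ∀ x → Corr d d' (to f) x (TIso.to h x)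
treeIso-induced (leaf _ _) (leaf _ _) h =
  record { to = H.to ; from = H.from ; ft = H.ft ; tf = H.tf
         ; pres = λ u v → bool-ext (H.reflN u v) (H.presN u v) } ,
  λ _ → refl
  where module H = TIso h
treeIso-induced (leaf _ _) (node Y ¬prime _ _ q _ _ Ts' _) h =
  ⊥-elim (TIso.presT (tiso⁻¹ h) (mk j) (mk' j) (arrow j))
  where j = someLabel {X = Y} ¬prime q
treeIso-induced (node X ¬prime _ _ p _ _ _ _) (leaf _ _) h =
  ⊥-elim (TIso.presT h (mk i) (mk' i) (arrow i))
  where i = someLabel {X = X} ¬prime p
treeIso-induced (node X ¬primeX ¬degX k p neX usedX Ts ds)
                (node Y ¬primeY ¬degY k' q neY usedY Ts' ds') h =
  G.gluedIso , G.glued-corr ¬primeX ¬degX neX ¬primeY ¬degY neY (λ i → proj₂ (induction i))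
  where
  open SubtreeIso ds ds' h using (π; subtreeIso)
  induction : ∀ i → Σ (Iso (induced X p i) (induced Y q (π i)))
                        λ g → ∀ x → Corr (ds i) (ds' (π i)) (to g) x (TIso.to (subtreeIso i) x)
  induction i = treeIso-induced (ds i) (ds' (π i)) (subtreeIso i)
  module G = GlueIso usedX usedY ds ds' h (λ i → proj₁ (induction i))

-- The leaf of T representing the vertex v of X: the vertices of X are
-- the normal vertices of the prime and degenerate nodes.
LeafOf : {A : Set} {X : Graph A} {T : Tree} → IsModTree X T → A → V T → Set
LeafOf (leaf _ _) v x = x ≡ v
LeafOf (node _ _ _ _ p _ _ _ ds) v (sub i x) = Σ (p v ≡ i) λ e → LeafOf (ds i) (v , e) x
LeafOf (node _ _ _ _ _ _ _ _ _) v (mk _)  = ⊥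
LeafOf (node _ _ _ _ _ _ _ _ _) v (mk' _) = ⊥

leaf-exists : {A : Set} {X : Graph A} {T : Tree} → (d : IsModTree X T) →
              ∀ v → Σ (V T) (LeafOf d v)
leaf-exists (leaf _ _) v = v , refl
leaf-exists (node _ _ _ _ p _ _ _ ds) v = sub (p v) (proj₁ inBlock) , refl , proj₂ inBlock
  where inBlock = leaf-exists (ds (p v)) (v , refl)

leaf-unique : {A : Set} {X : Graph A} {T : Tree} → (d : IsModTree X T) →
              ∀ {v w} x → LeafOf d v x → LeafOf d w x → v ≡ w
leaf-unique (leaf _ _) x lv lw = trans (≡-sym lv) lw
leaf-unique (node _ _ _ _ _ _ _ _ ds) (sub i x) (_ , lv) (_ , lw) =
  cong proj₁ (leaf-unique (ds i) x lv lw)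

leaf-corr : {A B : Set} {X : Graph A} {Y : Graph B} {T T' : Tree} →
  (d : IsModTree X T) (d' : IsModTree Y T') {f : A → B} →
  ∀ v x y → Corr d d' f x y → LeafOf d v x → LeafOf d' (f v) y
leaf-corr (leaf _ _) (leaf _ _) {f} v x y c l = trans (≡-sym c) (cong f l)
leaf-corr (node _ _ _ _ _ _ _ _ ds) (node _ _ _ _ _ _ _ _ ds') v (sub i x) (sub j y) (c , r) (e , l) =
  into c v e , leaf-corr (ds i) (ds' j) (v , e) x y r l

gaut→iso : GAut X → Iso X X
gaut→iso g = record
  { to = GAut.to g ; from = GAut.from g ; ft = GAut.ft g ; tf = GAut.tf g ; pres = GAut.pres g }

iso→gaut : Iso X X → GAut X
iso→gaut f = record { to = to f ; from = from f ; ft = ft f ; tf = tf f ; pres = pres f }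

taut→tiso : TAut T → TIso T T
taut→tiso h = record
  { to = TAut.to h ; from = TAut.from h ; ft = TAut.ft h ; tf = TAut.tf h ; presM = TAut.presM h
  ; presN = TAut.presN h ; reflN = TAut.reflN h ; presT = TAut.presT h ; reflT = TAut.reflT h }

tiso→taut : TIso T T → TAut T
tiso→taut h = record
  { to = TIso.to h ; from = TIso.from h ; ft = TIso.ft h ; tf = TIso.tf h ; presM = TIso.presM h
  ; presN = TIso.presN h ; reflN = TIso.reflN h ; presT = TIso.presT h ; reflT = TIso.reflT h }

-- Aut(X) ≅ Aut(T) for any graph X with modular tree T: φ sends an
-- automorphism to the tree automorphism it induces.  φ respects equality
-- and composition because correspondences do, it is injective because
-- leaves correspond to leaves, and surjective by treeIso-induced.
autIso : {A : Set} {X : Graph A} {T : Tree} → IsModTree X T → AutIso X T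
autIso {X = X} {T} d = record
  { φ = φ ; φ-≈ = respects ; φ-hom = homomorphism ; φ-inj = injective ; φ-sur = surjective }
  where
  φ : GAut X → TAut T
  φ g = tiso→taut (inducedTreeIso (gaut→iso g) d d)

  corr-φ : ∀ g x → Corr d d (GAut.to g) x (TAut.to (φ g) x)
  corr-φ g = induced-corr (gaut→iso g) d d

  φ-unique : ∀ g x y → Corr d d (GAut.to g) x y → TAut.to (φ g) x ≡ y
  φ-unique g x y = corr-functional d d x _ _ (corr-φ g x)

  respects : ∀ f g → f ≈G g → φ f ≈T φ g
  respects f g f≈g x = ≡-sym (φ-unique g x _ (corr-resp d d f≈g x _ (corr-φ f x)))

  homomorphism : ∀ f g → φ (f ∘G g) ≈T (φ f ∘T φ g)
  homomorphism f g x = φ-unique (f ∘G g) x _ (corr-comp d d d x _ _ (corr-φ g x) (corr-φ f _))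

  injective : ∀ f g → φ f ≈T φ g → f ≈G g
  injective f g φf≈φg v =
    leaf-unique d (TAut.to (φ g) x) (subst (LeafOf d _) (φf≈φg x) (leafImage f)) (leafImage g)
    where
    x = proj₁ (leaf-exists d v)
    leafImage : ∀ f → LeafOf d (GAut.to f v) (TAut.to (φ f) x)
    leafImage f = leaf-corr d d v x _ (corr-φ f x) (proj₂ (leaf-exists d v))

  surjective : ∀ h → Σ (GAut X) (λ f → φ f ≈T h)
  surjective h = f , λ x → φ-unique f x _ (proj₂ preimage x)
    where
    preimage = treeIso-induced d d (taut→tiso h)
    f = iso→gaut (proj₁ preimage)

mainTheorem2 : (n : ℕ) (X : Graph (Fin n)) (T : Tree) → IsModTree X T → AutIso X T
mainTheorem2 n X T = autIso
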